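{- Every chip configuration $\sigma$ on $K_n$ with $n^2-n<|\sigma|<n^2$ has eventual period $2$, where $|\sigma|=\sum_{v=1}^n\sigma(v)$.
   Context: Parallel chip-firing on $K_n$: a chip configuration is $\sigma:[n]\to\mathbb{Z}_{\ge0}$; let $r(\sigma)=\#\{v:\sigma(v)\ge n\}$ and $U\sigma(v)=\sigma(v)+r(\sigma)$ if $\sigma(v)\le n-1$, $U\sigma(v)=\sigma(v)-n+r(\sigma)$ if $\sigma(v)\ge n$. The eventual period of $\sigma$ is the least $m\ge1$ such that $U^{t+m}\sigma=U^t\sigma$ for all sufficiently large $t$. -}

module Defs where

open import Data.Nat using (ℕ; zero; suc; _+_; _*_; _∸_; _≤_; _<_; _≥_; _≤?_)
open import Data.Fin using (Fin)
open import Data.List using (List; length; filter; map)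
open import Data.Nat.ListAction using (sum)
open import Data.List using (allFin)
open import Data.Product using (Σ; ∃; _×_)
open import Relation.Nullary using (¬_; yes; no)
open import Relation.Binary.PropositionalEquality using (_≡_)

Config : ℕ → Set
Config n = Fin n → ℕ

total : ∀ {n} → Config n → ℕ
total {n} σ = sum (map σ (allFin n))

r : ∀ {n} → Config n → ℕ
r {n} σ = length (filter (λ v → n ≤? σ v) (allFin n))

-- parallel chip-firing update U on K_n
U : ∀ {n} → Config n → Config n
U {n} σ v with n ≤? σ v
... | yes _ = (σ v ∸ n) + r σ
... | no  _ = σ v + r σ

iterU : ∀ {n} → ℕ → Config n → Config n
iterU zero    σ = σ
iterU (suc t) σ = U (iterU t σ)

EventuallyPeriodicWith : ∀ {n} → Config n → ℕ → Set
EventuallyPeriodicWith σ m =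
  ∃ λ T → ∀ t → T ≤ t → ∀ v → iterU (t + m) σ v ≡ iterU t σ v

EventualPeriod : ∀ {n} → Config n → ℕ → Set
EventualPeriod σ m =
  1 ≤ m × EventuallyPeriodicWith σ m
        × (∀ k → 1 ≤ k → k < m → ¬ EventuallyPeriodicWith σ k)

module Submission where

-- The total S is invariant and r < n throughout, so after S steps every pile is below 2n and U
-- acts as σ(v) ↦ (σ(v) mod n) + r(σ).  From then on, with τ the configuration reached and p(s)
-- equal to n plus the number of firings so far, σ_{s+1}(v) = (τ(v) + p(s)) mod n + r(σ_s); summing
-- over v gives p(s + 1) = Q(p(s)) for Q(x) = Σ_v ⌊(τ(v) + x)/n⌋.  Q is a monotone lift of a
-- degree-one circle map of ℤ/n with Σ_{x<n} Q(x) = S (Hermite's identity).  Counting the lattice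
-- points under the graph of Q in two ways shows that n² − n < S < n² forces Q∘Q − n to have both a
-- sub- and a super-fixed point; hence p(s + 2) = p(s) + n eventually and the configuration becomes
-- 2-periodic.  It never becomes fixed: that would need r ∈ {0, n}, whereas r < n, and r ≥ 1 as soon
-- as all piles are below 2n.

open import Defs
open import Data.Bool using (true; false; if_then_else_)
open import Data.Empty using (⊥-elim)
open import Data.Fin using (Fin; fromℕ<)
open import Data.List using (List; []; _∷_; length; filter; map; allFin)
open import Data.List.Membership.Propositional using (_∈_)
open import Data.List.Membership.Propositional.Properties using (∈-allFin)
open import Data.List.Properties using (length-tabulate; map-cong)
open import Data.List.Relation.Unary.Any using (here; there)
open import Data.Nat
open import Data.Nat.Divisibility using (∣-refl)
open import Data.Nat.DivMod
open import Data.Nat.GeneralisedArithmetic using (fold)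
open import Data.Nat.ListAction using (sum)
open import Data.Nat.Properties
open import Data.Nat.Tactic.RingSolver using (solve-∀)
open import Data.Product using (_,_; _×_; ∃)
open import Data.Sum using (_⊎_; inj₁; inj₂; [_,_]′)
open import Function using (id)
open import Relation.Binary.PropositionalEquality
open import Relation.Nullary using (¬_; yes; no; does)
open import Relation.Unary using (Pred; Decidable)
open import Algebra.Properties.CommutativeSemigroup +-commutativeSemigroup
  using (interchange; xy∙z≈xz∙y; xy∙z≈x∙zy; xy∙z≈yz∙x; x∙yz≈xz∙y)

succ-closed⇒upward-closed : ∀ {q} (Q : ℕ → Set q) → (∀ s → Q s → Q (suc s)) →
                            ∀ {s t} → s ≤ t → Q s → Q t
succ-closed⇒upward-closed Q step {s} s≤t Qs = go (≤⇒≤′ s≤t)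
  where
  go : ∀ {t} → s ≤′ t → Q t
  go ≤′-refl         = Qs
  go (≤′-step s≤′t) = step _ (go s≤′t)

strict-growth : ∀ (f : ℕ → ℕ) d m → (∀ k → k < m → f k + d < f (suc k)) → f 0 + m * d + m ≤ f m
strict-growth f d zero    _    = ≤-reflexive (trans (+-identityʳ _) (+-identityʳ (f 0)))
strict-growth f d (suc m) grow = begin
  f 0 + suc m * d + suc m    ≡⟨ rearrange (f 0) d (m * d) m ⟩
  suc (f 0 + m * d + m + d)  ≤⟨ s≤s (+-monoˡ-≤ d (strict-growth f d m (λ k k<m → grow k (m≤n⇒m≤1+n k<m)))) ⟩
  suc (f m + d)              ≤⟨ grow m ≤-refl ⟩
  f (suc m)                  ∎
  where
  open ≤-Reasoning
  rearrange : ∀ a d e m → a + (d + e) + suc m ≡ suc (a + e + m + d)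
  rearrange = solve-∀

strict-decay : ∀ (f : ℕ → ℕ) d m → (∀ k → k < m → f (suc k) < f k + d) → f m + m ≤ f 0 + m * d
strict-decay f d zero    _     = ≤-reflexive (trans (+-identityʳ (f 0)) (sym (+-identityʳ (f 0))))
strict-decay f d (suc m) decay = begin
  f (suc m) + suc m     ≡⟨ +-suc (f (suc m)) m ⟩
  suc (f (suc m)) + m   ≤⟨ +-monoˡ-≤ m (decay m ≤-refl) ⟩
  f m + d + m           ≡⟨ xy∙z≈xz∙y (f m) d m ⟩
  f m + m + d           ≤⟨ +-monoˡ-≤ d (strict-decay f d m (λ k k<m → decay k (m≤n⇒m≤1+n k<m))) ⟩
  f 0 + m * d + d       ≡⟨ xy∙z≈x∙zy (f 0) (m * d) d ⟩
  f 0 + suc m * d       ∎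
  where open ≤-Reasoning

[m∸n]⊓n+m⊓n≡m : ∀ m n → m ≤ n + n → (m ∸ n) ⊓ n + m ⊓ n ≡ m
[m∸n]⊓n+m⊓n≡m m n m≤2n with m ≤? n
... | yes m≤n = begin
  (m ∸ n) ⊓ n + m ⊓ n   ≡⟨ cong₂ _+_ (cong (_⊓ n) (m≤n⇒m∸n≡0 m≤n)) (m≤n⇒m⊓n≡m m≤n) ⟩
  0 + m                  ∎
  where open ≡-Reasoning
... | no  m≰n = begin
  (m ∸ n) ⊓ n + m ⊓ n   ≡⟨ cong₂ _+_ (m≤n⇒m⊓n≡m m∸n≤n) (m≥n⇒m⊓n≡n n≤m) ⟩
  (m ∸ n) + n            ≡⟨ m∸n+n≡m n≤m ⟩
  m                      ∎
  where
  open ≡-Reasoning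
  n≤m : n ≤ m
  n≤m = <⇒≤ (≰⇒> m≰n)
  m∸n≤n : m ∸ n ≤ n
  m∸n≤n = ≤-trans (∸-monoˡ-≤ n m≤2n) (≤-reflexive (m+n∸n≡m n n))

[m+n]/n≡m/n+1 : ∀ m n .{{_ : NonZero n}} → (m + n) / n ≡ m / n + 1
[m+n]/n≡m/n+1 m n = trans (+-distrib-/-∣ʳ m (∣-refl {n})) (cong (m / n +_) (n/n≡1 n))

[m%n+o]%n≡[m+o]%n : ∀ m o n .{{_ : NonZero n}} → (m % n + o) % n ≡ (m + o) % n
[m%n+o]%n≡[m+o]%n m o n = begin
  (m % n + o) % n          ≡⟨ %-distribˡ-+ (m % n) o n ⟩
  (m % n % n + o % n) % n  ≡⟨ cong (λ z → (z + o % n) % n) (m%n%n≡m%n m n) ⟩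
  (m % n + o % n) % n      ≡⟨ %-distribˡ-+ m o n ⟨
  (m + o) % n              ∎
  where open ≡-Reasoning

𝟙 : ∀ {a p} {A : Set a} {P : Pred A p} → Decidable P → A → ℕ
𝟙 P? x = if does (P? x) then 1 else 0

module _ {a p} {A : Set a} {P : Pred A p} (P? : Decidable P) where

  𝟙-true : ∀ {x} → P x → 𝟙 P? x ≡ 1
  𝟙-true {x} px with P? x
  ... | yes _  = refl
  ... | no ¬px = ⊥-elim (¬px px)

  𝟙-false : ∀ {x} → ¬ P x → 𝟙 P? x ≡ 0
  𝟙-false {x} ¬px with P? x
  ... | yes px = ⊥-elim (¬px px)
  ... | no _   = refl

  𝟙≤1 : ∀ x → 𝟙 P? x ≤ 1
  𝟙≤1 x with P? x
  ... | yes _ = ≤-refl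
  ... | no _  = z≤n

∑< : ℕ → (ℕ → ℕ) → ℕ
∑< zero    f = 0
∑< (suc m) f = ∑< m f + f m

syntax ∑< m (λ x → e) = ∑[ x < m ] e

∑<-cong : ∀ m {f g : ℕ → ℕ} → (∀ x → x < m → f x ≡ g x) → ∑< m f ≡ ∑< m g
∑<-cong zero    f≡g = refl
∑<-cong (suc m) f≡g = cong₂ _+_ (∑<-cong m (λ x x<m → f≡g x (m≤n⇒m≤1+n x<m))) (f≡g m ≤-refl)

∑<-mono-≤ : ∀ m {f g : ℕ → ℕ} → (∀ x → x < m → f x ≤ g x) → ∑< m f ≤ ∑< m g
∑<-mono-≤ zero    f≤g = z≤n
∑<-mono-≤ (suc m) f≤g = +-mono-≤ (∑<-mono-≤ m (λ x x<m → f≤g x (m≤n⇒m≤1+n x<m))) (f≤g m ≤-refl)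

∑<-const : ∀ m c → ∑[ _ < m ] c ≡ m * c
∑<-const zero    c = refl
∑<-const (suc m) c = trans (cong (_+ c) (∑<-const m c)) (+-comm (m * c) c)

∑<-distrib-+ : ∀ m f g → ∑[ x < m ] (f x + g x) ≡ ∑< m f + ∑< m g
∑<-distrib-+ zero    f g = refl
∑<-distrib-+ (suc m) f g = trans (cong (_+ (f m + g m)) (∑<-distrib-+ m f g))
                                 (interchange (∑< m f) (∑< m g) (f m) (g m))

∑<-comm : ∀ m k (f : ℕ → ℕ → ℕ) → ∑[ x < m ] ∑[ y < k ] f x y ≡ ∑[ y < k ] ∑[ x < m ] f x y
∑<-comm zero    k f = sym (trans (∑<-const k 0) (*-zeroʳ k))
∑<-comm (suc m) k f = trans (cong (_+ ∑< k (f m)) (∑<-comm m k f))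
                            (sym (∑<-distrib-+ k (λ y → ∑[ x < m ] f x y) (f m)))

∑<-split : ∀ m k f → ∑< (m + k) f ≡ ∑< m f + ∑[ y < k ] f (m + y)
∑<-split m zero    f = trans (cong (λ l → ∑< l f) (+-identityʳ m)) (sym (+-identityʳ _))
∑<-split m (suc k) f = trans (cong (λ l → ∑< l f) (+-suc m k))
                             (trans (cong (_+ f (m + k)) (∑<-split m k f)) (+-assoc (∑< m f) _ _))

∑<-double : ∀ m f → ∑< (m + m) f ≡ ∑[ y < m ] (f y + f (m + y))
∑<-double m f = trans (∑<-split m m f) (sym (∑<-distrib-+ m f (λ y → f (m + y))))

∑<-rotate : ∀ m f → ∑[ x < m ] f (suc x) + f 0 ≡ ∑< m f + f m
∑<-rotate zero    f = refl
∑<-rotate (suc m) f = begin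
  ∑[ x < m ] f (suc x) + f (suc m) + f 0   ≡⟨ xy∙z≈xz∙y _ (f (suc m)) (f 0) ⟩
  ∑[ x < m ] f (suc x) + f 0 + f (suc m)   ≡⟨ cong (_+ f (suc m)) (∑<-rotate m f) ⟩
  ∑< m f + f m + f (suc m)                 ∎
  where open ≡-Reasoning

module _ {p} {P : Pred ℕ p} (P? : Decidable P) where

  ∑<-𝟙≤m : ∀ m → ∑[ y < m ] 𝟙 P? y ≤ m
  ∑<-𝟙≤m m = ≤-trans (∑<-mono-≤ m (λ y _ → 𝟙≤1 P? y))
                     (≤-reflexive (trans (∑<-const m 1) (*-identityʳ m)))

  ∑<-𝟙-≥ : ∀ {c M} → c < M → (∀ y → y ≤ c → P y) → suc c ≤ ∑[ y < M ] 𝟙 P? y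
  ∑<-𝟙-≥ {c} c<M Pc with m≤n⇒∃[o]m+o≡n c<M
  ... | d , refl = begin
    suc c                                                 ≡⟨ head≡suc-c ⟨
    ∑[ y < suc c ] 𝟙 P? y                                 ≤⟨ m≤m+n _ _ ⟩
    ∑[ y < suc c ] 𝟙 P? y + ∑[ y < d ] 𝟙 P? (suc c + y)   ≡⟨ ∑<-split (suc c) d (𝟙 P?) ⟨
    ∑[ y < suc c + d ] 𝟙 P? y                             ∎
    where
    open ≤-Reasoning
    head≡suc-c : ∑[ y < suc c ] 𝟙 P? y ≡ suc c
    head≡suc-c = trans (∑<-cong (suc c) (λ y y≤c → 𝟙-true P? (Pc y (≤-pred y≤c))))
                       (trans (∑<-const (suc c) 1) (*-identityʳ (suc c)))

  ∑<-𝟙-≤ : ∀ {c} M → (∀ y → c ≤ y → ¬ P y) → ∑[ y < M ] 𝟙 P? y ≤ c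
  ∑<-𝟙-≤ {c} M ¬P with M ≤? c
  ... | yes M≤c = ≤-trans (∑<-𝟙≤m M) M≤c
  ... | no  M≰c with m≤n⇒∃[o]m+o≡n (≰⇒≥ M≰c)
  ...   | d , refl = begin
    ∑[ y < c + d ] 𝟙 P? y                        ≡⟨ ∑<-split c d (𝟙 P?) ⟩
    ∑[ y < c ] 𝟙 P? y + ∑[ y < d ] 𝟙 P? (c + y)  ≡⟨ cong (∑[ y < c ] 𝟙 P? y +_) tail≡0 ⟩
    ∑[ y < c ] 𝟙 P? y + 0                         ≡⟨ +-identityʳ _ ⟩
    ∑[ y < c ] 𝟙 P? y                             ≤⟨ ∑<-𝟙≤m c ⟩
    c                                             ∎
    where
    open ≤-Reasoning
    tail≡0 : ∑[ y < d ] 𝟙 P? (c + y) ≡ 0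
    tail≡0 = trans (∑<-cong d (λ y _ → 𝟙-false P? (¬P (c + y) (m≤m+n c y))))
                   (trans (∑<-const d 0) (*-zeroʳ d))

∑<-𝟙-above : ∀ A m k → ∑[ x < k ] 𝟙 (A <?_) (x + m) ≡ k ∸ (suc A ∸ m)
∑<-𝟙-above A m zero    = sym (0∸n≡0 (suc A ∸ m))
∑<-𝟙-above A m (suc k) with A <? k + m
... | yes A<k+m = begin
  ∑[ x < suc k ] 𝟙 (A <?_) (x + m)   ≡⟨ cong₂ _+_ (∑<-𝟙-above A m k) (𝟙-true (A <?_) A<k+m) ⟩
  k ∸ (suc A ∸ m) + 1                ≡⟨ +-∸-comm 1 threshold≤k ⟨
  k + 1 ∸ (suc A ∸ m)                ≡⟨ cong (_∸ (suc A ∸ m)) (+-comm k 1) ⟩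
  suc k ∸ (suc A ∸ m)                ∎
  where
  open ≡-Reasoning
  threshold≤k : suc A ∸ m ≤ k
  threshold≤k = ≤-trans (∸-monoˡ-≤ m A<k+m) (≤-reflexive (m+n∸n≡m k m))
... | no A≮k+m = begin
  ∑[ x < suc k ] 𝟙 (A <?_) (x + m)   ≡⟨ cong₂ _+_ (∑<-𝟙-above A m k) (𝟙-false (A <?_) A≮k+m) ⟩
  k ∸ (suc A ∸ m) + 0                ≡⟨ cong (_+ 0) (m≤n⇒m∸n≡0 (≤-trans (n≤1+n k) k<threshold)) ⟩
  0                                  ≡⟨ m≤n⇒m∸n≡0 k<threshold ⟨
  suc k ∸ (suc A ∸ m)                ∎
  where
  open ≡-Reasoning
  k<threshold : suc k ≤ suc A ∸ m
  k<threshold = ≤-trans (≤-reflexive (sym (m+n∸n≡m (suc k) m))) (∸-monoˡ-≤ m (s≤s (≮⇒≥ A≮k+m)))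

hermite : ∀ n .{{_ : NonZero n}} a → ∑[ x < n ] ((a + x) / n) ≡ a
hermite n zero    = trans (∑<-cong n (λ x x<n → m<n⇒m/n≡0 x<n)) (trans (∑<-const n 0) (*-zeroʳ n))
hermite n (suc a) = +-cancelʳ-≡ (a / n) _ _ (begin
  ∑[ x < n ] ((suc a + x) / n) + a / n        ≡⟨ cong₂ _+_ (∑<-cong n (λ x _ → cong (_/ n) (sym (+-suc a x))))
                                                          (cong (_/ n) (sym (+-identityʳ a))) ⟩
  ∑[ x < n ] ((a + suc x) / n) + (a + 0) / n  ≡⟨ ∑<-rotate n (λ x → (a + x) / n) ⟩
  ∑[ x < n ] ((a + x) / n) + (a + n) / n      ≡⟨ cong₂ _+_ (hermite n a) ([m+n]/n≡m/n+1 a n) ⟩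
  a + (a / n + 1)                             ≡⟨ trans (cong (a +_) (+-comm (a / n) 1)) (+-suc a (a / n)) ⟩
  suc a + a / n                               ∎)
  where open ≡-Reasoning

module _ {a} {A : Set a} where

  sum-map-+ : ∀ (xs : List A) f g → sum (map (λ v → f v + g v) xs) ≡ sum (map f xs) + sum (map g xs)
  sum-map-+ []       f g = refl
  sum-map-+ (x ∷ xs) f g = trans (cong (f x + g x +_) (sum-map-+ xs f g))
                                 (interchange (f x) (g x) (sum (map f xs)) (sum (map g xs)))

  sum-map-const : ∀ (xs : List A) c → sum (map (λ _ → c) xs) ≡ length xs * c
  sum-map-const []       c = refl
  sum-map-const (x ∷ xs) c = cong (c +_) (sum-map-const xs c)

  sum-map-*ˡ : ∀ (xs : List A) c f → sum (map (λ v → c * f v) xs) ≡ c * sum (map f xs)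
  sum-map-*ˡ []       c f = sym (*-zeroʳ c)
  sum-map-*ˡ (x ∷ xs) c f = trans (cong (c * f x +_) (sum-map-*ˡ xs c f)) (sym (*-distribˡ-+ c (f x) _))

  sum-map-mono-≤ : ∀ (xs : List A) {f g : A → ℕ} → (∀ v → f v ≤ g v) → sum (map f xs) ≤ sum (map g xs)
  sum-map-mono-≤ []       f≤g = z≤n
  sum-map-mono-≤ (x ∷ xs) f≤g = +-mono-≤ (f≤g x) (sum-map-mono-≤ xs f≤g)

  sum-map-∈ : ∀ {xs : List A} f {x} → x ∈ xs → f x ≤ sum (map f xs)
  sum-map-∈ f (here refl) = m≤m+n _ _
  sum-map-∈ f (there x∈xs) = ≤-trans (sum-map-∈ f x∈xs) (m≤n+m _ _)

  ∑<-sum-map-comm : ∀ (xs : List A) m (f : A → ℕ → ℕ) →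
                    ∑[ x < m ] sum (map (λ v → f v x) xs) ≡ sum (map (λ v → ∑< m (f v)) xs)
  ∑<-sum-map-comm []       m f = trans (∑<-const m 0) (*-zeroʳ m)
  ∑<-sum-map-comm (y ∷ xs) m f = trans (∑<-distrib-+ m (f y) (λ x → sum (map (λ v → f v x) xs)))
                                       (cong (∑< m (f y) +_) (∑<-sum-map-comm xs m f))

  sum-map-𝟙 : ∀ {p} {P : Pred A p} (P? : Decidable P) xs → sum (map (𝟙 P?) xs) ≡ length (filter P? xs)
  sum-map-𝟙 P? []       = refl
  sum-map-𝟙 P? (x ∷ xs) with does (P? x)
  ... | true  = cong suc (sum-map-𝟙 P? xs)
  ... | false = sum-map-𝟙 P? xs

module DegreeOne (n : ℕ) (g : ℕ → ℕ)
  (g-mono : ∀ {x y} → x ≤ y → g x ≤ g y)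
  (g-periodic : ∀ x → g (n + x) ≡ n + g x) where

  g-+n : ∀ x → g (x + n) ≡ g x + n
  g-+n x = trans (cong g (+-comm x n)) (trans (g-periodic x) (+-comm n (g x)))

  g-+k*n : ∀ k x → g (k * n + x) ≡ k * n + g x
  g-+k*n zero    x = refl
  g-+k*n (suc k) x = begin
    g (n + k * n + x)    ≡⟨ cong g (+-assoc n (k * n) x) ⟩
    g (n + (k * n + x))  ≡⟨ g-periodic (k * n + x) ⟩
    n + g (k * n + x)    ≡⟨ cong (n +_) (g-+k*n k x) ⟩
    n + (k * n + g x)    ≡⟨ +-assoc n (k * n) (g x) ⟨
    n + k * n + g x      ∎
    where open ≡-Reasoning

  g²-+k*n : ∀ k x → g (g (k * n + x)) ≡ k * n + g (g x)
  g²-+k*n k x = trans (cong g (g-+k*n k x)) (g-+k*n k (g x))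

  gˢ-mono : ∀ s {z w} → z ≤ w → fold z g s ≤ fold w g s
  gˢ-mono zero    z≤w = z≤w
  gˢ-mono (suc s) z≤w = g-mono (gˢ-mono s z≤w)

  g²ᵐ-≥ : ∀ {a} → a + n ≤ g (g a) → ∀ m → m * n + a ≤ fold a g (m * 2)
  g²ᵐ-≥ {a} a+n≤g²a zero    = ≤-refl
  g²ᵐ-≥ {a} a+n≤g²a (suc m) = begin
    suc m * n + a             ≡⟨ xy∙z≈yz∙x n (m * n) a ⟩
    m * n + a + n             ≡⟨ +-assoc (m * n) a n ⟩
    m * n + (a + n)           ≤⟨ +-monoʳ-≤ (m * n) a+n≤g²a ⟩
    m * n + g (g a)           ≡⟨ g²-+k*n m a ⟨
    g (g (m * n + a))         ≤⟨ g-mono (g-mono (g²ᵐ-≥ a+n≤g²a m)) ⟩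
    g (g (fold a g (m * 2)))  ∎
    where open ≤-Reasoning

  g²ᵐ-≤ : ∀ {b} → g (g b) ≤ b + n → ∀ m → fold b g (m * 2) ≤ m * n + b
  g²ᵐ-≤ {b} g²b≤b+n zero    = ≤-refl
  g²ᵐ-≤ {b} g²b≤b+n (suc m) = begin
    g (g (fold b g (m * 2)))  ≤⟨ g-mono (g-mono (g²ᵐ-≤ g²b≤b+n m)) ⟩
    g (g (m * n + b))         ≡⟨ g²-+k*n m b ⟩
    m * n + g (g b)           ≤⟨ +-monoʳ-≤ (m * n) g²b≤b+n ⟩
    m * n + (b + n)           ≡⟨ +-assoc (m * n) b n ⟨
    m * n + b + n             ≡⟨ xy∙z≈yz∙x n (m * n) b ⟨
    suc m * n + b             ∎
    where open ≤-Reasoning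

  orbit : ℕ → ℕ
  orbit s = fold n g s

  Drift≤ Drift≥ : ℕ → Set
  Drift≤ s = orbit (2 + s) ≤ orbit s + n
  Drift≥ s = orbit s + n ≤ orbit (2 + s)

  Drift≤-upward : ∀ {s t} → s ≤ t → Drift≤ s → Drift≤ t
  Drift≤-upward = succ-closed⇒upward-closed Drift≤
    (λ s drift → ≤-trans (g-mono drift) (≤-reflexive (g-+n (orbit s))))

  Drift≥-upward : ∀ {s t} → s ≤ t → Drift≥ s → Drift≥ t
  Drift≥-upward = succ-closed⇒upward-closed Drift≥
    (λ s drift → ≤-trans (≤-reflexive (sym (g-+n (orbit s)))) (g-mono drift))

  -- A violation at 2n propagates back to every earlier double step, and n + 1 strict double steps
  -- outrun the orbit of b + n (resp. fall behind the orbit of a), which moves by at most (at least)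
  -- n per double step.
  Drift≤-2n : (∃ λ b → b < n × g (g b) ≤ b + n) → Drift≤ (n * 2)
  Drift≤-2n (b , b<n , g²b≤b+n) with orbit (2 + n * 2) ≤? orbit (n * 2) + n
  ... | yes drift = drift
  ... | no ¬drift = ⊥-elim (<-asym b<n (+-cancelˡ-≤ (suc n * n + n) (suc n) b (begin
    suc n * n + n + suc n       ≡⟨ cong (_+ suc n) (+-comm (suc n * n) n) ⟩
    n + suc n * n + suc n       ≤⟨ strict-growth (λ k → orbit (k * 2)) n (suc n) growing ⟩
    orbit (suc n * 2)           ≤⟨ gˢ-mono (suc n * 2) (m≤n+m n b) ⟩
    fold (b + n) g (suc n * 2)  ≤⟨ g²ᵐ-≤ g²[b+n]≤b+n+n (suc n) ⟩
    suc n * n + (b + n)         ≡⟨ x∙yz≈xz∙y (suc n * n) b n ⟩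
    suc n * n + n + b           ∎)))
    where
    open ≤-Reasoning
    g²[b+n]≤b+n+n : g (g (b + n)) ≤ b + n + n
    g²[b+n]≤b+n+n = begin
      g (g (b + n))  ≡⟨ trans (cong g (g-+n b)) (g-+n (g b)) ⟩
      g (g b) + n    ≤⟨ +-monoˡ-≤ n g²b≤b+n ⟩
      b + n + n      ∎
    growing : ∀ k → k < suc n → orbit (k * 2) + n < orbit (suc k * 2)
    growing k k<1+n = ≰⇒> (λ drift → ¬drift (Drift≤-upward (*-monoˡ-≤ 2 (≤-pred k<1+n)) drift))

  Drift≥-2n : (∃ λ a → a < n × a + n ≤ g (g a)) → Drift≥ (n * 2)
  Drift≥-2n (a , a<n , a+n≤g²a) with orbit (n * 2) + n ≤? orbit (2 + n * 2)
  ... | yes drift = drift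
  ... | no ¬drift = ⊥-elim (<-irrefl refl (≤-trans (m≤n+m (suc n) a) (+-cancelˡ-≤ (suc n * n) (a + suc n) n (begin
    suc n * n + (a + suc n)     ≡⟨ +-assoc (suc n * n) a (suc n) ⟨
    suc n * n + a + suc n       ≤⟨ +-monoˡ-≤ (suc n) (g²ᵐ-≥ a+n≤g²a (suc n)) ⟩
    fold a g (suc n * 2) + suc n ≤⟨ +-monoˡ-≤ (suc n) (gˢ-mono (suc n * 2) (<⇒≤ a<n)) ⟩
    orbit (suc n * 2) + suc n   ≤⟨ strict-decay (λ k → orbit (k * 2)) n (suc n) decaying ⟩
    n + suc n * n               ≡⟨ +-comm n (suc n * n) ⟩
    suc n * n + n               ∎))))
    where
    open ≤-Reasoning
    decaying : ∀ k → k < suc n → orbit (suc k * 2) < orbit (k * 2) + n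
    decaying k k<1+n = ≰⇒> (λ drift → ¬drift (Drift≥-upward (*-monoˡ-≤ 2 (≤-pred k<1+n)) drift))

  ∑g : ℕ
  ∑g = ∑< n g

  module _ (g-< : ∀ x → g x < x + n) where

    below : ℕ → ℕ
    below z = ∑[ y < n + n ] 𝟙 (λ y → g y <? z) y

    rows columns : ℕ → ℕ
    rows m    = ∑[ x < n ] below (x + m)
    columns m = ∑[ y < n + n ] ((suc (g y) ∸ m) ⊓ n)

    -- rows m counts the pairs (x, y) with x < n, y < 2n and g y < x + m; columns m counts the rest.
    columns+rows : ∀ m → columns m + rows m ≡ (n + n) * n
    columns+rows m = begin
      columns m + rows m
        ≡⟨ cong (columns m +_) (∑<-comm n (n + n) (λ x y → 𝟙 (g y <?_) (x + m))) ⟩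
      columns m + ∑[ y < n + n ] ∑[ x < n ] 𝟙 (g y <?_) (x + m)
        ≡⟨ cong (columns m +_) (∑<-cong (n + n) (λ y _ → ∑<-𝟙-above (g y) m n)) ⟩
      columns m + ∑[ y < n + n ] (n ∸ (suc (g y) ∸ m))
        ≡⟨ ∑<-distrib-+ (n + n) (λ y → (suc (g y) ∸ m) ⊓ n) (λ y → n ∸ (suc (g y) ∸ m)) ⟨
      ∑[ y < n + n ] ((suc (g y) ∸ m) ⊓ n + (n ∸ (suc (g y) ∸ m)))
        ≡⟨ ∑<-cong (n + n) (λ y _ → m⊓n+n∸m≡n (suc (g y) ∸ m) n) ⟩
      ∑[ _ < n + n ] n
        ≡⟨ ∑<-const (n + n) n ⟩
      (n + n) * n ∎
      where open ≡-Reasoning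

    suc-g<2n : ∀ y → y < n → suc (g y) ≤ n + n
    suc-g<2n y y<n = ≤-trans (g-< y) (+-monoˡ-≤ n (<⇒≤ y<n))

    ∑-suc-g : ∑[ y < n ] suc (g y) ≡ n + ∑g
    ∑-suc-g = trans (∑<-distrib-+ n (λ _ → 1) g) (cong (_+ ∑g) (trans (∑<-const n 1) (*-identityʳ n)))

    columns-n : columns n ≡ n + ∑g
    columns-n = begin
      ∑[ y < n + n ] ((suc (g y) ∸ n) ⊓ n)
        ≡⟨ ∑<-double n (λ y → (suc (g y) ∸ n) ⊓ n) ⟩
      ∑[ y < n ] ((suc (g y) ∸ n) ⊓ n + (suc (g (n + y)) ∸ n) ⊓ n)
        ≡⟨ ∑<-cong n (λ y y<n → trans (cong (λ z → (suc (g y) ∸ n) ⊓ n + z ⊓ n) (shifted y))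
                                       ([m∸n]⊓n+m⊓n≡m (suc (g y)) n (suc-g<2n y y<n))) ⟩
      ∑[ y < n ] suc (g y)
        ≡⟨ ∑-suc-g ⟩
      n + ∑g ∎
      where
      open ≡-Reasoning
      shifted : ∀ y → suc (g (n + y)) ∸ n ≡ suc (g y)
      shifted y = trans (cong (λ z → suc z ∸ n) (g-periodic y))
                        (trans (cong (_∸ n) (sym (+-suc n (g y)))) (m+n∸m≡n n (suc (g y))))

    columns-suc-n : columns (suc n) ≡ ∑g
    columns-suc-n = begin
      ∑[ y < n + n ] ((g y ∸ n) ⊓ n)
        ≡⟨ ∑<-double n (λ y → (g y ∸ n) ⊓ n) ⟩
      ∑[ y < n ] ((g y ∸ n) ⊓ n + (g (n + y) ∸ n) ⊓ n)
        ≡⟨ ∑<-cong n (λ y y<n → trans (cong (λ z → (g y ∸ n) ⊓ n + z ⊓ n) (shifted y))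
                                       ([m∸n]⊓n+m⊓n≡m (g y) n (<⇒≤ (suc-g<2n y y<n)))) ⟩
      ∑g ∎
      where
      open ≡-Reasoning
      shifted : ∀ y → g (n + y) ∸ n ≡ g y
      shifted y = trans (cong (_∸ n) (g-periodic y)) (m+n∸m≡n n (g y))

    ∃-g²-≥ : n * n < ∑g + n → ∃ λ a → a < n × a + n ≤ g (g a)
    ∃-g²-≥ lo with anyUpTo? (λ a → a + n ≤? g (g a)) n
    ... | yes found = found
    ... | no  none  = ⊥-elim (<⇒≱ (+-mono-< lo lo) (begin
      ∑g + n + (∑g + n)              ≡⟨ cong₂ _+_ (+-comm ∑g n) (+-comm ∑g n) ⟩
      n + ∑g + (n + ∑g)              ≡⟨ cong (n + ∑g +_) ∑-suc-g ⟨
      n + ∑g + ∑[ x < n ] suc (g x)  ≤⟨ +-monoʳ-≤ (n + ∑g) (∑<-mono-≤ n row) ⟩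
      n + ∑g + rows n                ≡⟨ cong (_+ rows n) columns-n ⟨
      columns n + rows n             ≡⟨ columns+rows n ⟩
      (n + n) * n                    ≡⟨ *-distribʳ-+ n n n ⟩
      n * n + n * n                  ∎))
      where
      open ≤-Reasoning
      row : ∀ x → x < n → suc (g x) ≤ below (x + n)
      row x x<n = ∑<-𝟙-≥ (λ y → g y <? x + n) (suc-g<2n x x<n)
        (λ y y≤gx → ≤-<-trans (g-mono y≤gx) (≰⇒> (λ x+n≤g²x → none (x , x<n , x+n≤g²x))))

    ∃-g²-≤ : ∑g < n * n → ∃ λ b → b < n × g (g b) ≤ b + n
    ∃-g²-≤ hi with anyUpTo? (λ b → g (g b) ≤? b + n) n
    ... | yes found = found
    ... | no  none  = ⊥-elim (<⇒≱ (+-mono-< hi hi) (begin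
      n * n + n * n                   ≡⟨ *-distribʳ-+ n n n ⟨
      (n + n) * n                     ≡⟨ columns+rows (suc n) ⟨
      columns (suc n) + rows (suc n)  ≡⟨ cong (_+ rows (suc n)) columns-suc-n ⟩
      ∑g + rows (suc n)               ≤⟨ +-monoʳ-≤ ∑g (∑<-mono-≤ n row) ⟩
      ∑g + ∑g                         ∎))
      where
      open ≤-Reasoning
      row : ∀ x → x < n → below (x + suc n) ≤ g x
      row x x<n = ∑<-𝟙-≤ (λ y → g y <? x + suc n) (n + n)
        (λ y gx≤y gy<x+1+n → none (x , x<n , (begin
          g (g x)    ≤⟨ g-mono gx≤y ⟩
          g y        ≤⟨ ≤-pred (≤-trans gy<x+1+n (≤-reflexive (+-suc x n))) ⟩
          x + n      ∎)))

    orbit-2-shift : n * n < ∑g + n → ∑g < n * n → ∀ s → n * 2 ≤ s → orbit (2 + s) ≡ orbit s + n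
    orbit-2-shift lo hi s n*2≤s =
      ≤-antisym (Drift≤-upward n*2≤s (Drift≤-2n (∃-g²-≤ hi)))
                (Drift≥-upward n*2≤s (Drift≥-2n (∃-g²-≥ lo)))

module ChipFiring (n : ℕ) .{{_ : NonZero n}} where

  vertices : List (Fin n)
  vertices = allFin n

  length-vertices : length vertices ≡ n
  length-vertices = length-tabulate id

  sum-vertices-const : ∀ c → sum (map (λ _ → c) vertices) ≡ n * c
  sum-vertices-const c = trans (sum-map-const vertices c) (cong (_* c) length-vertices)

  sum-vertices-1 : sum (map (λ _ → 1) vertices) ≡ n
  sum-vertices-1 = trans (sum-vertices-const 1) (*-identityʳ n)

  high? : (κ : Config n) → Decidable (λ v → n ≤ κ v)
  high? κ v = n ≤? κ v

  U-high : ∀ (κ : Config n) {v} → n ≤ κ v → U κ v ≡ κ v ∸ n + r κ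
  U-high κ {v} n≤κv with n ≤? κ v
  ... | yes _    = refl
  ... | no  n≰κv = ⊥-elim (n≰κv n≤κv)

  U-low : ∀ (κ : Config n) {v} → κ v < n → U κ v ≡ κ v + r κ
  U-low κ {v} κv<n with n ≤? κ v
  ... | yes n≤κv = ⊥-elim (<⇒≱ κv<n n≤κv)
  ... | no  _    = refl

  n*𝟙-high : ∀ (κ : Config n) {v} → n ≤ κ v → n * 𝟙 (high? κ) v ≡ n
  n*𝟙-high κ n≤κv = trans (cong (n *_) (𝟙-true (high? κ) n≤κv)) (*-identityʳ n)

  n*𝟙-low : ∀ (κ : Config n) {v} → κ v < n → n * 𝟙 (high? κ) v ≡ 0
  n*𝟙-low κ κv<n = trans (cong (n *_) (𝟙-false (high? κ) (<⇒≱ κv<n))) (*-zeroʳ n)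

  n*r≡∑n*𝟙 : ∀ (κ : Config n) → n * r κ ≡ sum (map (λ v → n * 𝟙 (high? κ) v) vertices)
  n*r≡∑n*𝟙 κ = trans (cong (n *_) (sym (sum-map-𝟙 (high? κ) vertices)))
                     (sym (sum-map-*ˡ vertices n (𝟙 (high? κ))))

  U+n*𝟙 : ∀ (κ : Config n) v → U κ v + n * 𝟙 (high? κ) v ≡ κ v + r κ
  U+n*𝟙 κ v with ≤-<-connex n (κ v)
  ... | inj₁ n≤κv = begin
    U κ v + n * 𝟙 (high? κ) v  ≡⟨ cong₂ _+_ (U-high κ n≤κv) (n*𝟙-high κ n≤κv) ⟩
    κ v ∸ n + r κ + n          ≡⟨ xy∙z≈xz∙y (κ v ∸ n) (r κ) n ⟩
    κ v ∸ n + n + r κ          ≡⟨ cong (_+ r κ) (m∸n+n≡m n≤κv) ⟩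
    κ v + r κ                  ∎
    where open ≡-Reasoning
  ... | inj₂ κv<n = trans (cong₂ _+_ (U-low κ κv<n) (n*𝟙-low κ κv<n)) (+-identityʳ _)

  total-U : ∀ (κ : Config n) → total (U κ) ≡ total κ
  total-U κ = +-cancelʳ-≡ (n * r κ) _ _ (begin
    total (U κ) + n * r κ                                 ≡⟨ cong (total (U κ) +_) (n*r≡∑n*𝟙 κ) ⟩
    total (U κ) + sum (map (λ v → n * 𝟙 (high? κ) v) vertices)
                                                          ≡⟨ sum-map-+ vertices (U κ) _ ⟨
    sum (map (λ v → U κ v + n * 𝟙 (high? κ) v) vertices)  ≡⟨ cong sum (map-cong (U+n*𝟙 κ) vertices) ⟩
    sum (map (λ v → κ v + r κ) vertices)                  ≡⟨ sum-map-+ vertices κ (λ _ → r κ) ⟩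
    total κ + sum (map (λ _ → r κ) vertices)              ≡⟨ cong (total κ +_) (sum-vertices-const (r κ)) ⟩
    total κ + n * r κ                                     ∎)
    where open ≡-Reasoning

  total-iterU : ∀ t (κ : Config n) → total (iterU t κ) ≡ total κ
  total-iterU zero    κ = refl
  total-iterU (suc t) κ = trans (total-U (iterU t κ)) (total-iterU t κ)

  iterU-+ : ∀ s t (κ : Config n) → iterU (s + t) κ ≡ iterU s (iterU t κ)
  iterU-+ zero    t κ = refl
  iterU-+ (suc s) t κ = cong U (iterU-+ s t κ)

  n*r≤total : ∀ (κ : Config n) → n * r κ ≤ total κ
  n*r≤total κ = ≤-trans (≤-reflexive (n*r≡∑n*𝟙 κ)) (sum-map-mono-≤ vertices n*𝟙≤κ)
    where
    n*𝟙≤κ : ∀ v → n * 𝟙 (high? κ) v ≤ κ v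
    n*𝟙≤κ v with ≤-<-connex n (κ v)
    ... | inj₁ n≤κv = ≤-trans (≤-reflexive (n*𝟙-high κ n≤κv)) n≤κv
    ... | inj₂ κv<n = ≤-trans (≤-reflexive (n*𝟙-low κ κv<n)) z≤n

  r<n : ∀ (κ : Config n) → total κ < n * n → r κ < n
  r<n κ total<n*n = *-cancelˡ-< n (r κ) n (≤-<-trans (n*r≤total κ) total<n*n)

  U<κ : ∀ (κ : Config n) {v} → r κ < n → n ≤ κ v → U κ v < κ v
  U<κ κ {v} r<n n≤κv = begin-strict
    U κ v          ≡⟨ U-high κ n≤κv ⟩
    κ v ∸ n + r κ  <⟨ +-monoʳ-< (κ v ∸ n) r<n ⟩
    κ v ∸ n + n    ≡⟨ m∸n+n≡m n≤κv ⟩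
    κ v            ∎
    where open ≤-Reasoning

  U<2n : ∀ (κ : Config n) {v} → r κ < n → κ v < n + n → U κ v < n + n
  U<2n κ {v} r<n κv<2n with ≤-<-connex n (κ v)
  ... | inj₁ n≤κv = <-trans (U<κ κ r<n n≤κv) κv<2n
  ... | inj₂ κv<n = subst (_< n + n) (sym (U-low κ κv<n)) (+-mono-< κv<n r<n)

  U-mod : ∀ (κ : Config n) {v} → κ v < n + n → U κ v ≡ κ v % n + r κ
  U-mod κ {v} κv<2n with ≤-<-connex n (κ v)
  ... | inj₁ n≤κv = begin
    U κ v              ≡⟨ U-high κ n≤κv ⟩
    κ v ∸ n + r κ      ≡⟨ cong (_+ r κ) (m<n⇒m%n≡m κv∸n<n) ⟨
    (κ v ∸ n) % n + r κ ≡⟨ cong (_+ r κ) (m≤n⇒[n∸m]%m≡n%m n≤κv) ⟩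
    κ v % n + r κ      ∎
    where
    open ≡-Reasoning
    κv∸n<n : κ v ∸ n < n
    κv∸n<n = +-cancelʳ-< n (κ v ∸ n) n (subst (_< n + n) (sym (m∸n+n≡m n≤κv)) κv<2n)
  ... | inj₂ κv<n = trans (U-low κ κv<n) (cong (_+ r κ) (sym (m<n⇒m%n≡m κv<n)))

  U-fixed⇒r≡0∨n : ∀ (κ : Config n) {v} → U κ v ≡ κ v → r κ ≡ 0 ⊎ r κ ≡ n
  U-fixed⇒r≡0∨n κ {v} fixed with ≤-<-connex n (κ v)
  ... | inj₁ n≤κv = inj₂ (+-cancelˡ-≡ (κ v ∸ n) (r κ) n (begin
    κ v ∸ n + r κ  ≡⟨ U-high κ n≤κv ⟨
    U κ v          ≡⟨ fixed ⟩
    κ v            ≡⟨ m∸n+n≡m n≤κv ⟨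
    κ v ∸ n + n    ∎))
    where open ≡-Reasoning
  ... | inj₂ κv<n = inj₁ (+-cancelˡ-≡ (κ v) (r κ) 0 (begin
    κ v + r κ  ≡⟨ U-low κ κv<n ⟨
    U κ v      ≡⟨ fixed ⟩
    κ v        ≡⟨ +-identityʳ (κ v) ⟨
    κ v + 0    ∎))
    where open ≡-Reasoning

  total+n≤n*n+n*r : ∀ (κ : Config n) → (∀ v → κ v < n + n) → total κ + n ≤ n * n + n * r κ
  total+n≤n*n+n*r κ κ<2n = begin
    total κ + n                                        ≡⟨ cong (total κ +_) sum-vertices-1 ⟨
    total κ + sum (map (λ _ → 1) vertices)             ≡⟨ sum-map-+ vertices κ (λ _ → 1) ⟨
    sum (map (λ v → κ v + 1) vertices)                 ≤⟨ sum-map-mono-≤ vertices κ+1≤n+n*𝟙 ⟩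
    sum (map (λ v → n + n * 𝟙 (high? κ) v) vertices)   ≡⟨ sum-map-+ vertices (λ _ → n) _ ⟩
    sum (map (λ _ → n) vertices) + sum (map (λ v → n * 𝟙 (high? κ) v) vertices)
                                                       ≡⟨ cong₂ _+_ (sum-vertices-const n) (sym (n*r≡∑n*𝟙 κ)) ⟩
    n * n + n * r κ                                    ∎
    where
    open ≤-Reasoning
    κ<n+n*𝟙 : ∀ v → κ v < n + n * 𝟙 (high? κ) v
    κ<n+n*𝟙 v with ≤-<-connex n (κ v)
    ... | inj₁ n≤κv = subst (λ z → κ v < n + z) (sym (n*𝟙-high κ n≤κv)) (κ<2n v)
    ... | inj₂ κv<n = subst (λ z → κ v < n + z) (sym (n*𝟙-low κ κv<n)) (<-≤-trans κv<n (m≤m+n n 0))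
    κ+1≤n+n*𝟙 : ∀ v → κ v + 1 ≤ n + n * 𝟙 (high? κ) v
    κ+1≤n+n*𝟙 v = ≤-trans (≤-reflexive (+-comm (κ v) 1)) (κ<n+n*𝟙 v)

  0<r : ∀ (κ : Config n) → (∀ v → κ v < n + n) → n * n < total κ + n → 0 < r κ
  0<r κ κ<2n n*n<total+n = n≢0⇒n>0 (λ r≡0 → <⇒≱ n*n<total+n (begin
    total κ + n      ≤⟨ total+n≤n*n+n*r κ κ<2n ⟩
    n * n + n * r κ  ≡⟨ cong (λ z → n * n + n * z) r≡0 ⟩
    n * n + n * 0    ≡⟨ trans (cong (n * n +_) (*-zeroʳ n)) (+-identityʳ (n * n)) ⟩
    n * n            ∎))
    where open ≤-Reasoning

  module Trajectory (σ : Config n) (total<n*n : total σ < n * n) where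


    r-iterU<n : ∀ t → r (iterU t σ) < n
    r-iterU<n t = r<n (iterU t σ) (subst (_< n * n) (sym (total-iterU t σ)) total<n*n)

    iterU-small-or-descending : ∀ t v → iterU t σ v < n + n ⊎ iterU t σ v + t ≤ σ v
    iterU-small-or-descending zero    v = inj₂ (≤-reflexive (+-identityʳ (σ v)))
    iterU-small-or-descending (suc t) v with iterU-small-or-descending t v
    ... | inj₁ small = inj₁ (U<2n (iterU t σ) (r-iterU<n t) small)
    ... | inj₂ descending with ≤-<-connex n (iterU t σ v)
    ...   | inj₁ n≤κv = inj₂ (begin
      U (iterU t σ) v + suc t    ≡⟨ +-suc _ t ⟩
      suc (U (iterU t σ) v) + t  ≤⟨ +-monoˡ-≤ t (U<κ (iterU t σ) (r-iterU<n t) n≤κv) ⟩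
      iterU t σ v + t            ≤⟨ descending ⟩
      σ v                        ∎)
      where open ≤-Reasoning
    ...   | inj₂ κv<n = inj₁ (U<2n (iterU t σ) (r-iterU<n t) (<-≤-trans κv<n (m≤m+n n n)))

    iterU-small : ∀ {t} → total σ ≤ t → ∀ v → iterU t σ v < n + n
    iterU-small {t} total≤t v with iterU-small-or-descending t v
    ... | inj₁ small      = small
    ... | inj₂ descending = ≤-<-trans (+-cancelʳ-≤ t (iterU t σ v) 0 (begin
      iterU t σ v + t  ≤⟨ descending ⟩
      σ v              ≤⟨ sum-map-∈ σ (∈-allFin v) ⟩
      total σ          ≤⟨ total≤t ⟩
      t                ∎)) (<-≤-trans (>-nonZero⁻¹ n) (m≤m+n n n))
      where open ≤-Reasoning

    S : ℕ
    S = total σ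

    τ : Config n
    τ = iterU S σ

    κ : ℕ → Config n
    κ s = iterU s τ

    κ-small : ∀ s v → κ s v < n + n
    κ-small s v = subst (λ κ′ → κ′ v < n + n) (iterU-+ s S σ) (iterU-small (m≤n+m S s) v)

    total-κ : ∀ s → total (κ s) ≡ S
    total-κ s = trans (total-iterU s τ) (total-iterU S σ)

    ρ : ℕ → ℕ
    ρ s = r (κ s)

    phase : ℕ → ℕ
    phase zero    = n
    phase (suc s) = phase s + ρ s

    κ-closed-form : ∀ s v → κ (suc s) v ≡ (τ v + phase s) % n + ρ s
    κ-closed-form zero    v = trans (U-mod τ (κ-small 0 v)) (cong (_+ ρ 0) (sym ([m+n]%n≡m%n (τ v) n)))
    κ-closed-form (suc s) v = begin
      U (κ (suc s)) v
        ≡⟨ U-mod (κ (suc s)) (κ-small (suc s) v) ⟩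
      κ (suc s) v % n + ρ (suc s)
        ≡⟨ cong (λ z → z % n + ρ (suc s)) (κ-closed-form s v) ⟩
      ((τ v + phase s) % n + ρ s) % n + ρ (suc s)
        ≡⟨ cong (_+ ρ (suc s)) ([m%n+o]%n≡[m+o]%n (τ v + phase s) (ρ s) n) ⟩
      (τ v + phase s + ρ s) % n + ρ (suc s)
        ≡⟨ cong (λ z → z % n + ρ (suc s)) (+-assoc (τ v) (phase s) (ρ s)) ⟩
      (τ v + phase (suc s)) % n + ρ (suc s) ∎
      where open ≡-Reasoning

    remainders Q : ℕ → ℕ
    remainders x = sum (map (λ v → (τ v + x) % n) vertices)
    Q x          = sum (map (λ v → (τ v + x) / n) vertices)

    remainders+n*ρ : ∀ s → remainders (phase s) + n * ρ s ≡ S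
    remainders+n*ρ s = begin
      remainders (phase s) + n * ρ s
        ≡⟨ cong (remainders (phase s) +_) (sum-vertices-const (ρ s)) ⟨
      remainders (phase s) + sum (map (λ _ → ρ s) vertices)
        ≡⟨ sum-map-+ vertices (λ v → (τ v + phase s) % n) (λ _ → ρ s) ⟨
      sum (map (λ v → (τ v + phase s) % n + ρ s) vertices)
        ≡⟨ cong sum (map-cong (λ v → sym (κ-closed-form s v)) vertices) ⟩
      total (κ (suc s))
        ≡⟨ total-κ (suc s) ⟩
      S ∎
      where open ≡-Reasoning

    remainders+n*Q : ∀ x → remainders x + n * Q x ≡ S + n * x
    remainders+n*Q x = begin
      remainders x + n * Q x
        ≡⟨ cong (remainders x +_) (sum-map-*ˡ vertices n _) ⟨
      remainders x + sum (map (λ v → n * ((τ v + x) / n)) vertices)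
        ≡⟨ sum-map-+ vertices _ _ ⟨
      sum (map (λ v → (τ v + x) % n + n * ((τ v + x) / n)) vertices)
        ≡⟨ cong sum (map-cong division vertices) ⟨
      sum (map (λ v → τ v + x) vertices)
        ≡⟨ sum-map-+ vertices τ (λ _ → x) ⟩
      total τ + sum (map (λ _ → x) vertices)
        ≡⟨ cong₂ _+_ (total-κ 0) (sum-vertices-const x) ⟩
      S + n * x ∎
      where
      open ≡-Reasoning
      division : ∀ v → τ v + x ≡ (τ v + x) % n + n * ((τ v + x) / n)
      division v = trans (m≡m%n+[m/n]*n (τ v + x) n) (cong ((τ v + x) % n +_) (*-comm ((τ v + x) / n) n))

    phase-suc : ∀ s → phase (suc s) ≡ Q (phase s)
    phase-suc s = *-cancelˡ-≡ (phase s + ρ s) (Q (phase s)) n (+-cancelˡ-≡ R _ _ (begin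
      R + n * (phase s + ρ s)      ≡⟨ cong (R +_) (*-distribˡ-+ n (phase s) (ρ s)) ⟩
      R + (n * phase s + n * ρ s)  ≡⟨ x∙yz≈xz∙y R (n * phase s) (n * ρ s) ⟩
      R + n * ρ s + n * phase s    ≡⟨ cong (_+ n * phase s) (remainders+n*ρ s) ⟩
      S + n * phase s              ≡⟨ remainders+n*Q (phase s) ⟨
      R + n * Q (phase s)          ∎))
      where
      open ≡-Reasoning
      R : ℕ
      R = remainders (phase s)

    Q-mono : ∀ {x y} → x ≤ y → Q x ≤ Q y
    Q-mono x≤y = sum-map-mono-≤ vertices (λ v → /-monoˡ-≤ n (+-monoʳ-≤ (τ v) x≤y))

    Q-periodic : ∀ x → Q (n + x) ≡ n + Q x
    Q-periodic x = begin
      Q (n + x)                                             ≡⟨ cong sum (map-cong shift vertices) ⟩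
      sum (map (λ v → (τ v + x) / n + 1) vertices)          ≡⟨ sum-map-+ vertices _ (λ _ → 1) ⟩
      Q x + sum (map (λ _ → 1) vertices)                    ≡⟨ cong (Q x +_) sum-vertices-1 ⟩
      Q x + n                                               ≡⟨ +-comm (Q x) n ⟩
      n + Q x                                               ∎
      where
      open ≡-Reasoning
      shift : ∀ v → (τ v + (n + x)) / n ≡ (τ v + x) / n + 1
      shift v = trans (cong (_/ n) (x∙yz≈xz∙y (τ v) n x)) ([m+n]/n≡m/n+1 (τ v + x) n)

    Q-< : ∀ x → Q x < x + n
    Q-< x = *-cancelˡ-< n (Q x) (x + n) (begin-strict
      n * Q x                  ≤⟨ m≤n+m (n * Q x) (remainders x) ⟩
      remainders x + n * Q x   ≡⟨ remainders+n*Q x ⟩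
      S + n * x                <⟨ +-monoˡ-< (n * x) total<n*n ⟩
      n * n + n * x            ≡⟨ *-distribˡ-+ n n x ⟨
      n * (n + x)              ≡⟨ cong (n *_) (+-comm n x) ⟩
      n * (x + n)              ∎)
      where open ≤-Reasoning

    ∑Q≡S : ∑< n Q ≡ S
    ∑Q≡S = begin
      ∑< n Q                                            ≡⟨ ∑<-sum-map-comm vertices n (λ v x → (τ v + x) / n) ⟩
      sum (map (λ v → ∑[ x < n ] ((τ v + x) / n)) vertices)
                                                        ≡⟨ cong sum (map-cong (λ v → hermite n (τ v)) vertices) ⟩
      total τ                                           ≡⟨ total-κ 0 ⟩
      S                                                 ∎
      where open ≡-Reasoning

    open DegreeOne n Q Q-mono Q-periodic using (orbit; orbit-2-shift)

    phase≡orbit : ∀ s → phase s ≡ orbit s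
    phase≡orbit zero    = refl
    phase≡orbit (suc s) = trans (phase-suc s) (cong Q (phase≡orbit s))

    module _ (n*n<S+n : n * n < S + n) where

      phase-2-shift : ∀ s → n * 2 ≤ s → phase (2 + s) ≡ phase s + n
      phase-2-shift s n*2≤s = begin
        phase (2 + s)  ≡⟨ phase≡orbit (2 + s) ⟩
        orbit (2 + s)  ≡⟨ orbit-2-shift Q-< (subst (λ z → n * n < z + n) (sym ∑Q≡S) n*n<S+n)
                                            (subst (_< n * n) (sym ∑Q≡S) total<n*n) s n*2≤s ⟩
        orbit s + n    ≡⟨ cong (_+ n) (phase≡orbit s) ⟨
        phase s + n    ∎
        where open ≡-Reasoning

      ρ-2-periodic : ∀ s → n * 2 ≤ s → ρ (2 + s) ≡ ρ s
      ρ-2-periodic s n*2≤s = +-cancelˡ-≡ (phase s + n) (ρ (2 + s)) (ρ s) (begin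
        phase s + n + ρ (2 + s)  ≡⟨ cong (_+ ρ (2 + s)) (phase-2-shift s n*2≤s) ⟨
        phase (3 + s)            ≡⟨ phase-2-shift (suc s) (m≤n⇒m≤1+n n*2≤s) ⟩
        phase s + ρ s + n        ≡⟨ xy∙z≈xz∙y (phase s) (ρ s) n ⟩
        phase s + n + ρ s        ∎)
        where open ≡-Reasoning

      κ-2-periodic : ∀ s → n * 2 ≤ s → ∀ v → κ (3 + s) v ≡ κ (1 + s) v
      κ-2-periodic s n*2≤s v = begin
        κ (3 + s) v                           ≡⟨ κ-closed-form (2 + s) v ⟩
        (τ v + phase (2 + s)) % n + ρ (2 + s) ≡⟨ cong₂ (λ p q → (τ v + p) % n + q)
                                                        (phase-2-shift s n*2≤s) (ρ-2-periodic s n*2≤s) ⟩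
        (τ v + (phase s + n)) % n + ρ s       ≡⟨ cong (λ z → z % n + ρ s) (+-assoc (τ v) (phase s) n) ⟨
        (τ v + phase s + n) % n + ρ s         ≡⟨ cong (_+ ρ s) ([m+n]%n≡m%n (τ v + phase s) n) ⟩
        (τ v + phase s) % n + ρ s             ≡⟨ κ-closed-form s v ⟨
        κ (1 + s) v                           ∎
        where open ≡-Reasoning

      eventually-2-periodic : EventuallyPeriodicWith σ 2
      eventually-2-periodic = suc (n * 2) + S , periodic
        where
        periodic : ∀ t → suc (n * 2) + S ≤ t → ∀ v → iterU (t + 2) σ v ≡ iterU t σ v
        periodic t T≤t v with m≤n⇒∃[o]m+o≡n T≤t
        ... | d , refl = begin
          iterU (suc (n * 2) + S + d + 2) σ v  ≡⟨ cong (λ t → iterU t σ v) (shuffle₃ (n * 2) S d) ⟩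
          iterU (3 + (n * 2 + d) + S) σ v      ≡⟨ cong (λ κ′ → κ′ v) (iterU-+ (3 + (n * 2 + d)) S σ) ⟩
          κ (3 + (n * 2 + d)) v                ≡⟨ κ-2-periodic (n * 2 + d) (m≤m+n (n * 2) d) v ⟩
          κ (1 + (n * 2 + d)) v                ≡⟨ cong (λ κ′ → κ′ v) (iterU-+ (1 + (n * 2 + d)) S σ) ⟨
          iterU (1 + (n * 2 + d) + S) σ v      ≡⟨ cong (λ t → iterU t σ v) (shuffle₁ (n * 2) S d) ⟩
          iterU (suc (n * 2) + S + d) σ v      ∎
          where
          open ≡-Reasoning
          shuffle₃ : ∀ a b c → suc a + b + c + 2 ≡ 3 + (a + c) + b
          shuffle₃ = solve-∀
          shuffle₁ : ∀ a b c → 1 + (a + c) + b ≡ suc a + b + c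
          shuffle₁ = solve-∀

      not-eventually-fixed : ¬ EventuallyPeriodicWith σ 1
      not-eventually-fixed (T , periodic) =
        [ (λ r≡0 → <⇒≢ (0<r κ′ (iterU-small (m≤n+m S T)) n*n<total+n) (sym r≡0))
        , (λ r≡n → <⇒≢ (r-iterU<n (T + S)) r≡n)
        ]′ (U-fixed⇒r≡0∨n κ′ fixed)
        where
        κ′ : Config n
        κ′ = iterU (T + S) σ
        v₀ : Fin n
        v₀ = fromℕ< (>-nonZero⁻¹ n)
        fixed : U κ′ v₀ ≡ κ′ v₀
        fixed = trans (cong (λ t → iterU t σ v₀) (+-comm 1 (T + S))) (periodic (T + S) (m≤m+n T S) v₀)
        n*n<total+n : n * n < total κ′ + n
        n*n<total+n = subst (λ z → n * n < z + n) (sym (total-iterU (T + S) σ)) n*n<S+n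

theorem4p13 : (n : ℕ) (σ : Config n) →
    n * n ∸ n < total σ → total σ < n * n → EventualPeriod σ 2
theorem4p13 zero      σ _           ()
theorem4p13 n@(suc _) σ n*n∸n<total total<n*n =
  s≤s z≤n , eventually-2-periodic n*n<S+n , no-smaller-period
  where
  open ChipFiring n
  open Trajectory σ total<n*n
  n*n<S+n : n * n < S + n
  n*n<S+n = begin-strict
    n * n            ≤⟨ m≤n+m∸n (n * n) n ⟩
    n + (n * n ∸ n)  <⟨ +-monoʳ-< n n*n∸n<total ⟩
    n + S            ≡⟨ +-comm n S ⟩
    S + n            ∎
    where open ≤-Reasoning
  no-smaller-period : ∀ k → 1 ≤ k → k < 2 → ¬ EventuallyPeriodicWith σ k
  no-smaller-period 1             _ _                = not-eventually-fixed n*n<S+n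
  no-smaller-period (suc (suc _)) _ (s≤s (s≤s ()))
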